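{- Let $w=a_0^{k_0}y_1a_1^{k_1}\cdots y_na_n^{k_n}$ be a $\mathcal G$-factorization and let $\sim_{\mathcal C}$ be the relation on $\{1,\dots,n\}$ defined below. If $i\sim_{\mathcal C}\ell$, $\ell\sim_{\mathcal C}m$ and $m\sim_{\mathcal C}j$, then $i\sim_{\mathcal C}j$.
   Context: A GBS graph of groups $\mathcal G$: a finite connected graph $Y$ in Serre's sense (vertices $V(Y)$, edges $E(Y)$, maps $\iota,\tau$, fixed-point-free involution $y\mapsto\bar y$ with $\iota(y)=\tau(\bar y)$) and integers $\alpha_y,\beta_y\in\mathbb Z\setminus\{0\}$ with $\alpha_y=\beta_{\bar y}$. A $\mathcal G$-factorization is a word $a_0^{k_0}y_1a_1^{k_1}\cdots y_na_n^{k_n}$ with $y_i\in E(Y)$, $\iota(y_i)=a_{i-1}$, $\tau(y_i)=a_i$, $a_n=a_0$, $k_i\in\mathbb Z$. Write $\alpha_\mu=\alpha_{y_\mu}$, $\beta_\mu=\beta_{y_\mu}$. For $0\le i\le j\le n$ let $w_{i,j}=a_i^{k_i}y_{i+1}a_{i+1}^{k_{i+1}}\cdots y_ja_j^{k_j}$ and $k_{i,j}=\sum_{\nu=i}^{j}k_\nu\prod_{\mu=i+1}^{\nu}\frac{\alpha_\mu}{\beta_\mu}\in\mathbb Q$. Fix an orientation $D\subseteq E(Y)$ (so $E(Y)$ is the disjoint union of $D$ and $\bar D=\{\bar y:y\in D\}$) and let $\rho$ be the monoid homomorphism from words over $E(Y)\cup\{a^k\}$ to $\mathbb Z^D$ with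 $\rho(a^k)=0$, $\rho(y)=e_y$ and $\rho(\bar y)=-e_y$ for $y\in D$ ($e_y$ the unit vector). Define $i\sim_{\mathcal C}j$ for $i,j\in\{1,\dots,n\}$ iff $y_i=\bar y_j$ and: if $i<j$ then $\rho(w_{i,j-1})=0$ and $k_{i,j-1}\in\beta_i\mathbb Z$; if $j<i$ then $\rho(w_{j,i-1})=0$ and $k_{j,i-1}\in\beta_j\mathbb Z$ (in particular never $i\sim_{\mathcal C}i$). -}

module Defs where

open import Data.Nat as ℕ using (ℕ; zero; suc; _∸_; _≤_; _<_)
open import Data.Fin using (Fin)
open import Data.Fin.Properties using () renaming (_≟_ to _≟ᶠ_)
open import Data.Integer as ℤ using (ℤ; +_; -[1+_]; +[1+_])
open import Data.Rational as ℚ using (ℚ; _/_)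
open import Data.Bool using (Bool; true; false; not)
open import Data.Product using (Σ; ∃; _×_)
open import Data.List using (List; []; _∷_)
open import Relation.Nullary using (¬_; yes; no)
open import Relation.Binary.PropositionalEquality using (_≡_)

-- A finite graph in Serre's sense with V(Y) = Fin nV and E(Y) = Fin nE.
-- Walks: a list of edges, each starting where the previous one ended.
module _ {nV nE : ℕ} (ι τ : Fin nE → Fin nV) where
  data Walk : Fin nV → Fin nV → Set where
    nil  : ∀ {v} → Walk v v
    cons : ∀ {u} (e : Fin nE) {v} → ι e ≡ u → Walk (τ e) v → Walk u v

record GBSGraph : Set where
  field
    nV nE     : ℕ
    ι τ       : Fin nE → Fin nV
    bar       : Fin nE → Fin nE
    bar-invol : ∀ y → bar (bar y) ≡ y
    bar-free  : ∀ y → ¬ (bar y ≡ y)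
    ι-bar     : ∀ y → ι y ≡ τ (bar y)
    connected : ∀ u v → Walk ι τ u v
    α β       : Fin nE → ℤ
    α≢0       : ∀ y → ¬ (α y ≡ + 0)
    β≢0       : ∀ y → ¬ (β y ≡ + 0)
    α-bar     : ∀ y → α y ≡ β (bar y)

-- An orientation D ⊆ E(Y), given by its characteristic function:
-- exactly one of y, ȳ lies in D.
record Orientation (G : GBSGraph) : Set where
  open GBSGraph G
  field
    inD     : Fin nE → Bool
    inD-bar : ∀ y → inD (bar y) ≡ not (inD y)

-- A G-factorization a₀^{k₀} y₁ a₁^{k₁} ⋯ yₙ aₙ^{kₙ}; sequences are indexed
-- by ℕ and only the values at indices 0..n (resp. 1..n for y) matter.
record Factorization (G : GBSGraph) : Set where
  open GBSGraph G
  field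
    n     : ℕ
    a     : ℕ → Fin nV
    k     : ℕ → ℤ
    y     : ℕ → Fin nE
    y-ι   : ∀ i → 1 ≤ i → i ≤ n → ι (y i) ≡ a (i ∸ 1)
    y-τ   : ∀ i → 1 ≤ i → i ≤ n → τ (y i) ≡ a i
    a-cyc : a n ≡ a 0

-- rational p/q for integers (q ≠ 0 in all uses; value 0 for q = 0)
_÷ᶻ_ : ℤ → ℤ → ℚ
p ÷ᶻ (+ zero)   = ℚ.0ℚ
p ÷ᶻ +[1+ m ]   = p / suc m
p ÷ᶻ -[1+ m ]   = (ℤ.- p) / suc m

ι/ : ℤ → ℚ
ι/ z = z / 1

prodRange : (ℕ → ℚ) → ℕ → ℕ → ℚ
prodRange f s zero    = ℚ.1ℚ
prodRange f s (suc l) = f s ℚ.* prodRange f (suc s) l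

sumRange : (ℕ → ℚ) → ℕ → ℕ → ℚ
sumRange g s zero    = ℚ.0ℚ
sumRange g s (suc l) = g s ℚ.+ sumRange g (suc s) l

module _ {G : GBSGraph} (O : Orientation G) (F : Factorization G) where
  open GBSGraph G
  open Orientation O
  open Factorization F

  ratio : ℕ → ℚ
  ratio μ = α (y μ) ÷ᶻ β (y μ)

  -- k_{i,j} = Σ_{ν=i}^{j} k_ν ∏_{μ=i+1}^{ν} α_μ/β_μ
  kij : ℕ → ℕ → ℚ
  kij i j = sumRange (λ ν → ι/ (k ν) ℚ.* prodRange ratio (suc i) (ν ∸ i)) i (suc (j ∸ i))

  -- coordinate d (d ∈ D) of ρ(x) for a single edge x
  ρedge : Fin nE → Fin nE → ℤ
  ρedge d x with x ≟ᶠ d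
  ... | yes _ = + 1
  ... | no _ with x ≟ᶠ bar d
  ...   | yes _ = ℤ.- (+ 1)
  ...   | no _  = + 0

  -- coordinate d of ρ(y_s ⋯ y_{s+len-1}) (the a^k letters contribute 0)
  ρRange : Fin nE → ℕ → ℕ → ℤ
  ρRange d s zero    = + 0
  ρRange d s (suc l) = ρedge d (y s) ℤ.+ ρRange d (suc s) l

  -- ρ(w_{i,j}) = 0 in ℤ^D; w_{i,j} contains the edges y_{i+1},…,y_j
  ρw≡0 : ℕ → ℕ → Set
  ρw≡0 i j = ∀ d → inD d ≡ true → ρRange d (suc i) (j ∸ i) ≡ + 0

  InMultiples : ℚ → ℤ → Set
  InMultiples q b = ∃ λ (z : ℤ) → q ≡ ι/ b ℚ.* ι/ z

  cond : ℕ → ℕ → Set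
  cond p q = ρw≡0 p (q ∸ 1) × InMultiples (kij p (q ∸ 1)) (β (y p))

  _∼C_ : ℕ → ℕ → Set
  i ∼C j = (1 ≤ i × i ≤ n) × (1 ≤ j × j ≤ n) × (y i ≡ bar (y j))
         × (i < j → cond i j) × (j < i → cond j i)

-- Along the factorization consider the prefix quantities
--   ρ⁺(p) = ρ(y₁ ⋯ y_p),  R(p) = ∏_{μ≤p} α_μ/β_μ,  K(p) = Σ_{ν<p} k_ν R(ν).
-- Then ρ(w_{i,j}) = ρ⁺(j) − ρ⁺(i) and R(i)·k_{i,j} = K(j+1) − K(i), so for
-- i < j the condition defining i ∼_C j says: ρ⁺(i) = ρ⁺(j−1) on D, and
-- K(j) ≡ K(i) modulo β_i R(i) ℤ ("Linked i j").  The key fact is that R(p)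
-- depends only on ρ⁺(p): R(p) = Φ(ρ⁺(p)) for the character
-- Φ(v) = ∏_{d∈D} (α_d/β_d)^{v_d}, which is well defined because α_ȳ/β_ȳ is
-- the inverse of α_y/β_y.  Hence Linked pairs carrying inverse edges have the
-- same scale β_i R(i) = β_j R(j), Linked becomes symmetric, and three links
-- compose by adding the integer witnesses.
module Submission where

open import Defs
open import Data.Nat as ℕ using (ℕ; zero; suc; _≤_; _<_; _∸_; s≤s)
import Data.Nat.Properties as ℕP
open import Data.Integer as ℤ using (ℤ; +_; -[1+_]; +[1+_])
import Data.Integer.Properties as ℤP
open import Data.Integer.Solver renaming (module +-*-Solver to ℤSolver)
open import Data.Rational as ℚ using (ℚ; 0ℚ; 1ℚ; _/_; toℚᵘ; 1/_)
import Data.Rational.Properties as ℚP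
open import Data.Rational.Solver renaming (module +-*-Solver to ℚSolver)
open import Data.Rational.Unnormalised as ℚᵘ using (ℚᵘ; mkℚᵘ; *≡*)
import Data.Rational.Unnormalised.Properties as ℚᵘP
open import Relation.Binary.PropositionalEquality
  using (_≡_; _≢_; refl; sym; trans; cong; cong₂; module ≡-Reasoning)
open import Relation.Nullary using (¬_; yes; no)
open import Data.Empty using (⊥-elim)
open import Algebra.Bundles using (Monoid; AbelianGroup)
open import Data.Fin using (Fin; punchIn)
open import Data.Fin.Properties using (punchInᵢ≢i) renaming (_≟_ to _≟ᶠ_)
open import Data.Bool using (true; false; not; if_then_else_)
open import Data.Product using (∃; _×_; _,_; proj₁; proj₂)
open import Relation.Binary.Definitions using (tri<; tri≈; tri>)
open import Function using (_∘_)
import Algebra.Properties.Group as GroupProperties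
module ℤGroup = GroupProperties (AbelianGroup.group ℤP.+-0-abelianGroup)
module ℚGroup = GroupProperties ℚP.+-0-group

ι/-toℚᵘ : ∀ a → toℚᵘ (ι/ a) ℚᵘ.≃ mkℚᵘ a 0
ι/-toℚᵘ a = ℚP.toℚᵘ-fromℚᵘ (mkℚᵘ a 0)

viaℚᵘ : ∀ {p q : ℚ} (u : ℚᵘ) → toℚᵘ p ℚᵘ.≃ u → toℚᵘ q ℚᵘ.≃ u → p ≡ q
viaℚᵘ u p≃u q≃u = ℚP.toℚᵘ-injective (ℚᵘP.≃-trans p≃u (ℚᵘP.≃-sym q≃u))

ι/-+ : ∀ a b → ι/ (a ℤ.+ b) ≡ ι/ a ℚ.+ ι/ b
ι/-+ a b = viaℚᵘ (mkℚᵘ a 0 ℚᵘ.+ mkℚᵘ b 0)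
  (ℚᵘP.≃-trans (ι/-toℚᵘ (a ℤ.+ b)) (*≡* (ℤSolver.solve 2 (λ a b →
     (a :+ b) :* con (+ 1) := (a :* con (+ 1) :+ b :* con (+ 1)) :* con (+ 1)) refl a b)))
  (ℚᵘP.≃-trans (ℚP.toℚᵘ-homo-+ (ι/ a) (ι/ b)) (ℚᵘP.+-cong (ι/-toℚᵘ a) (ι/-toℚᵘ b)))
  where open ℤSolver

ι/-neg : ∀ a → ι/ (ℤ.- a) ≡ ℚ.- ι/ a
ι/-neg a = viaℚᵘ (mkℚᵘ (ℤ.- a) 0) (ι/-toℚᵘ (ℤ.- a))
  (ℚᵘP.≃-trans (ℚP.toℚᵘ-homo‿- (ι/ a)) (ℚᵘP.-‿cong (ι/-toℚᵘ a)))

ι/-≢0 : ∀ {a} → ¬ a ≡ + 0 → ¬ ι/ a ≡ 0ℚ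
ι/-≢0 {a} a≢0 ι/a≡0 with ℚᵘP.≃-trans (ℚᵘP.≃-sym (ι/-toℚᵘ a)) (ℚP.toℚᵘ-cong ι/a≡0)
... | *≡* eq = a≢0 (trans (sym (ℤP.*-identityʳ a)) eq)

ι/-÷ᶻ : ∀ p q → ¬ q ≡ + 0 → ι/ q ℚ.* (p ÷ᶻ q) ≡ ι/ p
ι/-÷ᶻ p (+ zero) q≢0 = ⊥-elim (q≢0 refl)
ι/-÷ᶻ p +[1+ m ] _ = viaℚᵘ (mkℚᵘ p 0)
  (ℚᵘP.≃-trans (ℚP.toℚᵘ-homo-* (ι/ +[1+ m ]) (p / suc m))
    (ℚᵘP.≃-trans (ℚᵘP.*-cong (ι/-toℚᵘ +[1+ m ]) (ℚP.toℚᵘ-fromℚᵘ (mkℚᵘ p m)))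
      (*≡* (trans (ℤSolver.solve 2 (λ q p → (q :* p) :* con (+ 1) := p :* q) refl +[1+ m ] p)
                  (cong (λ t → p ℤ.* + t) (sym (ℕP.*-identityˡ (suc m))))))))
  (ι/-toℚᵘ p)
  where open ℤSolver
ι/-÷ᶻ p -[1+ m ] _ = viaℚᵘ (mkℚᵘ p 0)
  (ℚᵘP.≃-trans (ℚP.toℚᵘ-homo-* (ι/ -[1+ m ]) ((ℤ.- p) / suc m))
    (ℚᵘP.≃-trans (ℚᵘP.*-cong (ι/-toℚᵘ -[1+ m ]) (ℚP.toℚᵘ-fromℚᵘ (mkℚᵘ (ℤ.- p) m)))
      (*≡* (trans (ℤSolver.solve 2 (λ q p → ((:- q) :* (:- p)) :* con (+ 1) := p :* q) refl +[1+ m ] p)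
                  (cong (λ t → p ℤ.* + t) (sym (ℕP.*-identityˡ (suc m))))))))
  (ι/-toℚᵘ p)
  where open ℤSolver

*-cancelˡ-≢0 : ∀ {x a b} → ¬ x ≡ 0ℚ → x ℚ.* a ≡ x ℚ.* b → a ≡ b
*-cancelˡ-≢0 {x} {a} {b} x≢0 eq = begin
  a                    ≡⟨ undo a ⟨
  1/ x ℚ.* (x ℚ.* a)   ≡⟨ cong (1/ x ℚ.*_) eq ⟩
  1/ x ℚ.* (x ℚ.* b)   ≡⟨ undo b ⟩
  b                    ∎
  where
  open ≡-Reasoning
  instance _ = ℚ.≢-nonZero x≢0
  undo : ∀ c → 1/ x ℚ.* (x ℚ.* c) ≡ c
  undo c = trans (sym (ℚP.*-assoc (1/ x) x c))
                 (trans (cong (ℚ._* c) (ℚP.*-inverseˡ x)) (ℚP.*-identityˡ c))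

÷ᶻ-inverse : ∀ {p q} → ¬ p ≡ + 0 → ¬ q ≡ + 0 → (p ÷ᶻ q) ℚ.* (q ÷ᶻ p) ≡ 1ℚ
÷ᶻ-inverse {p} {q} p≢0 q≢0 = *-cancelˡ-≢0 (ι/-≢0 q≢0) (begin
  ι/ q ℚ.* ((p ÷ᶻ q) ℚ.* (q ÷ᶻ p))  ≡⟨ ℚP.*-assoc (ι/ q) _ _ ⟨
  (ι/ q ℚ.* (p ÷ᶻ q)) ℚ.* (q ÷ᶻ p)  ≡⟨ cong (ℚ._* (q ÷ᶻ p)) (ι/-÷ᶻ p q q≢0) ⟩
  ι/ p ℚ.* (q ÷ᶻ p)                 ≡⟨ ι/-÷ᶻ q p p≢0 ⟩
  ι/ q                              ≡⟨ ℚP.*-identityʳ (ι/ q) ⟨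
  ι/ q ℚ.* 1ℚ                       ∎)
  where open ≡-Reasoning

invertible⇒≢0 : ∀ {x s} → x ℚ.* s ≡ 1ℚ → ¬ x ≡ 0ℚ
invertible⇒≢0 {x} {s} xs≡1 x≡0 with trans (sym xs≡1) (trans (cong (ℚ._* s) x≡0) (ℚP.*-zeroˡ s))
... | ()

*-≢0 : ∀ {x y} → ¬ x ≡ 0ℚ → ¬ y ≡ 0ℚ → ¬ x ℚ.* y ≡ 0ℚ
*-≢0 {x} x≢0 y≢0 xy≡0 = y≢0 (*-cancelˡ-≢0 x≢0 (trans xy≡0 (sym (ℚP.*-zeroʳ x))))

-- Folds over index ranges: F s l is g s ∙ g (s+1) ∙ ⋯ ∙ g (s+l-1) in a
-- monoid.  prodRange, sumRange and ρRange satisfy the two defining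
-- equations definitionally, so the splitting laws are proved once here.
module RangeFold {c ℓ} (M : Monoid c ℓ) where
  open Monoid M using (Carrier; _≈_; _∙_; ε; setoid; reflexive; assoc;
                       identityˡ; identityʳ; ∙-cong; ∙-congˡ; ∙-congʳ)
  open import Relation.Binary.Reasoning.Setoid setoid

  module Laws (g : ℕ → Carrier) (F : ℕ → ℕ → Carrier)
           (F-zero : ∀ s → F s 0 ≈ ε)
           (F-suc : ∀ s l → F s (suc l) ≈ g s ∙ F (suc s) l) where

    fold-split : ∀ s a b → F s (a ℕ.+ b) ≈ F s a ∙ F (s ℕ.+ a) b
    fold-split s zero b = begin
      F s b                  ≈⟨ reflexive (cong (λ t → F t b) (ℕP.+-identityʳ s)) ⟨
      F (s ℕ.+ 0) b          ≈⟨ identityˡ _ ⟨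
      ε ∙ F (s ℕ.+ 0) b      ≈⟨ ∙-congʳ (F-zero s) ⟨
      F s 0 ∙ F (s ℕ.+ 0) b  ∎
    fold-split s (suc a) b = begin
      F s (suc (a ℕ.+ b))                    ≈⟨ F-suc s (a ℕ.+ b) ⟩
      g s ∙ F (suc s) (a ℕ.+ b)              ≈⟨ ∙-congˡ (fold-split (suc s) a b) ⟩
      g s ∙ (F (suc s) a ∙ F (suc s ℕ.+ a) b) ≈⟨ assoc _ _ _ ⟨
      (g s ∙ F (suc s) a) ∙ F (suc s ℕ.+ a) b ≈⟨ ∙-cong (F-suc s a) (reflexive (cong (λ t → F t b) (ℕP.+-suc s a))) ⟨
      F s (suc a) ∙ F (s ℕ.+ suc a) b         ∎

    fold-snoc : ∀ s l → F s (suc l) ≈ F s l ∙ g (s ℕ.+ l)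
    fold-snoc s l = begin
      F s (suc l)                  ≈⟨ reflexive (cong (F s) (ℕP.+-comm 1 l)) ⟩
      F s (l ℕ.+ 1)                ≈⟨ fold-split s l 1 ⟩
      F s l ∙ F (s ℕ.+ l) 1        ≈⟨ ∙-congˡ (F-suc (s ℕ.+ l) 0) ⟩
      F s l ∙ (g (s ℕ.+ l) ∙ F _ 0) ≈⟨ ∙-congˡ (∙-congˡ (F-zero _)) ⟩
      F s l ∙ (g (s ℕ.+ l) ∙ ε)    ≈⟨ ∙-congˡ (identityʳ _) ⟩
      F s l ∙ g (s ℕ.+ l)          ∎

sumRange-scale : ∀ c g s l → c ℚ.* sumRange g s l ≡ sumRange (λ ν → c ℚ.* g ν) s l
sumRange-scale c g s zero    = ℚP.*-zeroʳ c
sumRange-scale c g s (suc l) =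
  trans (ℚP.*-distribˡ-+ c (g s) _) (cong (c ℚ.* g s ℚ.+_) (sumRange-scale c g (suc s) l))

sumRange-cong : ∀ {g h} s l → (∀ ν → s ≤ ν → g ν ≡ h ν) → sumRange g s l ≡ sumRange h s l
sumRange-cong s zero    g≡h = refl
sumRange-cong s (suc l) g≡h =
  cong₂ ℚ._+_ (g≡h s ℕP.≤-refl) (sumRange-cong (suc s) l (λ ν s<ν → g≡h ν (ℕP.<⇒≤ s<ν)))

offset-zero⇒≡ : ∀ {a b x} → b ≡ a ℤ.+ x → x ≡ + 0 → a ≡ b
offset-zero⇒≡ {a} b≡a+x refl = trans (sym (ℤP.+-identityʳ a)) (sym b≡a+x)

≡⇒offset-zero : ∀ {a b x} → b ≡ a ℤ.+ x → a ≡ b → x ≡ + 0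
≡⇒offset-zero {a} b≡a+x a≡b = ℤGroup.∙-cancelˡ a _ _
  (trans (sym b≡a+x) (trans (sym a≡b) (sym (ℤP.+-identityʳ a))))

open import Algebra.Properties.CommutativeMonoid.Sum ℚP.*-1-commutativeMonoid
  using () renaming (sum to ∏; sum-cong-≗ to ∏-cong; ∑-distrib-+ to ∏-distrib;
                     sum-remove to ∏-remove; sum-replicate-zero to ∏-ones)

∏-single : ∀ {n} (f : Fin n → ℚ) (i : Fin n) → (∀ j → j ≢ i → f j ≡ 1ℚ) → ∏ f ≡ f i
∏-single {suc n} f i others = begin
  ∏ f                            ≡⟨ ∏-remove {i = i} f ⟩
  f i ℚ.* ∏ (f ∘ punchIn i)      ≡⟨ cong (f i ℚ.*_) (trans (∏-cong λ j → others _ (punchInᵢ≢i i j)) (∏-ones n)) ⟩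
  f i ℚ.* 1ℚ                     ≡⟨ ℚP.*-identityʳ (f i) ⟩
  f i                            ∎
  where open ≡-Reasoning

-- Natural and integer powers.  zpow r s is the integer power of r when s is
-- an inverse of r: zpow r s (+ n) = rⁿ and zpow r s -[1+ n ] = s^(n+1).
_^_ : ℚ → ℕ → ℚ
x ^ zero  = 1ℚ
x ^ suc n = x ℚ.* x ^ n

zpow : ℚ → ℚ → ℤ → ℚ
zpow r s (+ n)     = r ^ n
zpow r s -[1+ n ]  = s ^ suc n

zpow-neg : ∀ r s z → zpow s r (ℤ.- z) ≡ zpow r s z
zpow-neg r s (+ zero)   = refl
zpow-neg r s +[1+ n ]   = refl
zpow-neg r s -[1+ n ]   = refl

zpow-+1 : ∀ {r s} → r ℚ.* s ≡ 1ℚ → ∀ z → zpow r s (z ℤ.+ + 1) ≡ zpow r s z ℚ.* r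
zpow-+1 {r} {s} rs≡1 (+ n) rewrite ℕP.+-comm n 1 = ℚP.*-comm r (r ^ n)
zpow-+1 {r} {s} rs≡1 -[1+ zero ] = begin
  1ℚ               ≡⟨ rs≡1 ⟨
  r ℚ.* s          ≡⟨ ℚSolver.solve 2 (λ r s → r :* s := (s :* con 1ℚ) :* r) refl r s ⟩
  s ^ 1 ℚ.* r      ∎
  where open ≡-Reasoning; open ℚSolver
zpow-+1 {r} {s} rs≡1 -[1+ suc n ] = begin
  s ^ suc n                        ≡⟨ ℚP.*-identityˡ _ ⟨
  1ℚ ℚ.* s ^ suc n                 ≡⟨ cong (ℚ._* s ^ suc n) rs≡1 ⟨
  (r ℚ.* s) ℚ.* s ^ suc n          ≡⟨ ℚSolver.solve 3 (λ r s t → (r :* s) :* t := (s :* t) :* r) refl r s (s ^ suc n) ⟩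
  s ^ suc (suc n) ℚ.* r            ∎
  where open ≡-Reasoning; open ℚSolver

zpow--1 : ∀ {r s} → r ℚ.* s ≡ 1ℚ → ∀ z → zpow r s (z ℤ.+ -[1+ 0 ]) ≡ zpow r s z ℚ.* s
zpow--1 {r} {s} rs≡1 z = begin
  zpow r s (z ℤ.+ -[1+ 0 ])            ≡⟨ zpow-neg r s (z ℤ.+ -[1+ 0 ]) ⟨
  zpow s r (ℤ.- (z ℤ.+ -[1+ 0 ]))      ≡⟨ cong (zpow s r) (ℤP.neg-distrib-+ z -[1+ 0 ]) ⟩
  zpow s r (ℤ.- z ℤ.+ + 1)             ≡⟨ zpow-+1 (trans (ℚP.*-comm s r) rs≡1) (ℤ.- z) ⟩
  zpow s r (ℤ.- z) ℚ.* s               ≡⟨ cong (ℚ._* s) (zpow-neg r s z) ⟩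
  zpow r s z ℚ.* s                     ∎
  where open ≡-Reasoning

data Step : ℤ → Set where
  up   : Step (+ 1)
  down : Step -[1+ 0 ]
  stay : Step (+ 0)

zpow-step : ∀ {r s} → r ℚ.* s ≡ 1ℚ → ∀ z {e} → Step e → zpow r s (z ℤ.+ e) ≡ zpow r s z ℚ.* zpow r s e
zpow-step {r} {s} rs≡1 z up   = trans (zpow-+1 rs≡1 z) (cong (zpow r s z ℚ.*_) (sym (ℚP.*-identityʳ r)))
zpow-step {r} {s} rs≡1 z down = trans (zpow--1 rs≡1 z) (cong (zpow r s z ℚ.*_) (sym (ℚP.*-identityʳ s)))
zpow-step rs≡1 z stay = trans (cong (zpow _ _) (ℤP.+-identityʳ z)) (sym (ℚP.*-identityʳ _))

module _ {G : GBSGraph} (O : Orientation G) (F : Factorization G) where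
  open GBSGraph G
  open Orientation O
  open Factorization F

  r : Fin nE → ℚ
  r x = α x ÷ᶻ β x

  -- Reversing an edge inverts its ratio, since α_ȳ = β_y and β_ȳ = α_y.
  r-inverse : ∀ x → r x ℚ.* r (bar x) ≡ 1ℚ
  r-inverse x = trans (cong (r x ℚ.*_) r-bar) (÷ᶻ-inverse (α≢0 x) (β≢0 x))
    where
    r-bar : r (bar x) ≡ β x ÷ᶻ α x
    r-bar = cong₂ _÷ᶻ_ (trans (α-bar (bar x)) (cong β (bar-invol x))) (sym (α-bar x))

  bar-injective : ∀ {x z} → bar x ≡ bar z → x ≡ z
  bar-injective {x} {z} e = trans (sym (bar-invol x)) (trans (cong bar e) (bar-invol z))

  ρedge-self : ∀ d → ρedge O F d d ≡ + 1
  ρedge-self d with d ≟ᶠ d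
  ... | yes _ = refl
  ... | no d≢d = ⊥-elim (d≢d refl)

  ρedge-bar : ∀ d → ρedge O F d (bar d) ≡ -[1+ 0 ]
  ρedge-bar d with bar d ≟ᶠ d
  ... | yes b≡d = ⊥-elim (bar-free d b≡d)
  ... | no _ with bar d ≟ᶠ bar d
  ...   | yes _ = refl
  ...   | no b≢b = ⊥-elim (b≢b refl)

  ρedge-other : ∀ d x → x ≢ d → x ≢ bar d → ρedge O F d x ≡ + 0
  ρedge-other d x x≢d x≢b with x ≟ᶠ d
  ... | yes x≡d = ⊥-elim (x≢d x≡d)
  ... | no _ with x ≟ᶠ bar d
  ...   | yes x≡b = ⊥-elim (x≢b x≡b)
  ...   | no _ = refl

  ρedge-step : ∀ d x → Step (ρedge O F d x)
  ρedge-step d x with x ≟ᶠ d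
  ... | yes _ = up
  ... | no _ with x ≟ᶠ bar d
  ...   | yes _ = down
  ...   | no _ = stay

  ρedge-rev : ∀ d x → ρedge O F d (bar x) ≡ ℤ.- ρedge O F d x
  ρedge-rev d x with x ≟ᶠ d
  ... | yes refl = ρedge-bar x
  ... | no x≢d with x ≟ᶠ bar d
  ...   | yes refl = trans (cong (ρedge O F d) (bar-invol d)) (ρedge-self d)
  ...   | no x≢b = ρedge-other d (bar x) (λ e → x≢b (trans (sym (bar-invol x)) (cong bar e)))
                                       (λ e → x≢d (bar-injective e))

  -- The character Φ : ℤ^D → ℚ*, Φ(v) = ∏_{d ∈ D} r_d^{v_d}.  It is written as a
  -- product over all edges whose factor χ d is trivial for d ∉ D.
  χ : Fin nE → ℤ → ℚ
  χ d z = if inD d then zpow (r d) (r (bar d)) z else 1ℚ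

  Φ : (Fin nE → ℤ) → ℚ
  Φ v = ∏ (λ d → χ d (v d))

  χ-step : ∀ d z x → χ d (z ℤ.+ ρedge O F d x) ≡ χ d z ℚ.* χ d (ρedge O F d x)
  χ-step d z x with inD d
  ... | true  = zpow-step (r-inverse d) z (ρedge-step d x)
  ... | false = sym (ℚP.*-identityˡ 1ℚ)

  χ-zero : ∀ d → χ d (+ 0) ≡ 1ℚ
  χ-zero d with inD d
  ... | true  = refl
  ... | false = refl

  χ-edge-trivial : ∀ d x → (inD d ≡ true → d ≢ x) → (inD d ≡ true → d ≢ bar x) →
                   χ d (ρedge O F d x) ≡ 1ℚ
  χ-edge-trivial d x d≢x d≢x̄ with inD d in d∈D
  ... | false = refl
  ... | true  = cong (zpow (r d) (r (bar d))) (ρedge-other d x x≢d x≢d̄)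
    where
    x≢d : x ≢ d
    x≢d x≡d = d≢x refl (sym x≡d)
    x≢d̄ : x ≢ bar d
    x≢d̄ x≡d̄ = d≢x̄ refl (trans (sym (bar-invol d)) (cong bar (sym x≡d̄)))

  -- Φ(ρ(x)) = r x: only the representative of {x, x̄} in D contributes.
  Φ-edge : ∀ x → ∏ (λ d → χ d (ρedge O F d x)) ≡ r x
  Φ-edge x with inD x in x∈D
  ... | true = trans (∏-single _ x (λ d d≢x → χ-edge-trivial d x (λ _ → d≢x) (not-bar d)))
                     (trans (cong (χ x) (ρedge-self x)) at-x)
    where
    not-bar : ∀ d → inD d ≡ true → d ≢ bar x
    not-bar d d∈D refl with () ← trans (sym d∈D) (trans (inD-bar x) (cong not x∈D))
    at-x : χ x (+ 1) ≡ r x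
    at-x rewrite x∈D = ℚP.*-identityʳ (r x)
  ... | false = trans (∏-single _ (bar x) (λ d d≢x̄ → χ-edge-trivial d x (not-x d) (λ _ → d≢x̄)))
                      (trans (cong (χ (bar x)) ρ-at-x̄) at-x̄)
    where
    not-x : ∀ d → inD d ≡ true → d ≢ x
    not-x d d∈D refl with () ← trans (sym d∈D) x∈D
    ρ-at-x̄ : ρedge O F (bar x) x ≡ -[1+ 0 ]
    ρ-at-x̄ = trans (cong (ρedge O F (bar x)) (sym (bar-invol x))) (ρedge-bar (bar x))
    at-x̄ : χ (bar x) -[1+ 0 ] ≡ r x
    at-x̄ rewrite inD-bar x | x∈D | bar-invol x = ℚP.*-identityʳ (r x)

  Φ-step : ∀ v x → Φ (λ d → v d ℤ.+ ρedge O F d x) ≡ Φ v ℚ.* r x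
  Φ-step v x = begin
    Φ (λ d → v d ℤ.+ ρedge O F d x)                  ≡⟨ ∏-cong (λ d → χ-step d (v d) x) ⟩
    ∏ (λ d → χ d (v d) ℚ.* χ d (ρedge O F d x))     ≡⟨ ∏-distrib (λ d → χ d (v d)) (λ d → χ d (ρedge O F d x)) ⟩
    Φ v ℚ.* ∏ (λ d → χ d (ρedge O F d x))           ≡⟨ cong (Φ v ℚ.*_) (Φ-edge x) ⟩
    Φ v ℚ.* r x                                     ∎
    where open ≡-Reasoning

  Φ-zero : Φ (λ _ → + 0) ≡ 1ℚ
  Φ-zero = trans (∏-cong χ-zero) (∏-ones nE)

  Φ-cong : ∀ v w → (∀ d → inD d ≡ true → v d ≡ w d) → Φ v ≡ Φ w
  Φ-cong v w v≡w = ∏-cong agree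
    where
    agree : ∀ d → χ d (v d) ≡ χ d (w d)
    agree d with inD d in d∈D
    ... | true  = cong (zpow (r d) (r (bar d))) (v≡w d d∈D)
    ... | false = refl

  ρ⁺ : Fin nE → ℕ → ℤ
  ρ⁺ d p = ρRange O F d 1 p

  R : ℕ → ℚ
  R p = prodRange (ratio O F) 1 p

  weighted : ℕ → ℚ
  weighted ν = ι/ (k ν) ℚ.* R ν

  K : ℕ → ℚ
  K p = sumRange weighted 0 p

  scale : ℕ → ℚ
  scale p = ι/ (β (y p)) ℚ.* R p

  private
    module ρFold d = RangeFold.Laws ℤP.+-0-monoid (λ ν → ρedge O F d (y ν)) (ρRange O F d)
                                    (λ _ → refl) (λ _ _ → refl)
    module RFold = RangeFold.Laws ℚP.*-1-monoid (ratio O F) (prodRange (ratio O F))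
                                  (λ _ → refl) (λ _ _ → refl)
    module KFold = RangeFold.Laws ℚP.+-0-monoid weighted (sumRange weighted)
                                  (λ _ → refl) (λ _ _ → refl)

  ρ⁺-split : ∀ d {i j} → i ≤ j → ρ⁺ d j ≡ ρ⁺ d i ℤ.+ ρRange O F d (suc i) (j ∸ i)
  ρ⁺-split d {i} {j} i≤j = trans (cong (ρ⁺ d) (sym (ℕP.m+[n∸m]≡n i≤j))) (ρFold.fold-split d 1 i (j ∸ i))

  ρ⁺-snoc : ∀ d p → ρ⁺ d (suc p) ≡ ρ⁺ d p ℤ.+ ρedge O F d (y (suc p))
  ρ⁺-snoc d p = ρFold.fold-snoc d 1 p

  R-snoc : ∀ p → R (suc p) ≡ R p ℚ.* r (y (suc p))
  R-snoc p = RFold.fold-snoc 1 p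

  R-Φ : ∀ p → R p ≡ Φ (λ d → ρ⁺ d p)
  R-Φ zero    = sym Φ-zero
  R-Φ (suc p) = begin
    R (suc p)                                        ≡⟨ R-snoc p ⟩
    R p ℚ.* r (y (suc p))                            ≡⟨ cong (ℚ._* r (y (suc p))) (R-Φ p) ⟩
    Φ (λ d → ρ⁺ d p) ℚ.* r (y (suc p))               ≡⟨ Φ-step (λ d → ρ⁺ d p) (y (suc p)) ⟨
    Φ (λ d → ρ⁺ d p ℤ.+ ρedge O F d (y (suc p)))     ≡⟨ Φ-cong _ _ (λ d _ → sym (ρ⁺-snoc d p)) ⟩
    Φ (λ d → ρ⁺ d (suc p))                           ∎
    where open ≡-Reasoning

  R-cong : ∀ {p q} → (∀ d → inD d ≡ true → ρ⁺ d p ≡ ρ⁺ d q) → R p ≡ R q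
  R-cong {p} {q} same = trans (R-Φ p) (trans (Φ-cong _ _ same) (sym (R-Φ q)))

  ratio≢0 : ∀ μ → ratio O F μ ≢ 0ℚ
  ratio≢0 μ = invertible⇒≢0 (r-inverse (y μ))

  prodRange≢0 : ∀ s l → prodRange (ratio O F) s l ≢ 0ℚ
  prodRange≢0 s zero    ()
  prodRange≢0 s (suc l) = *-≢0 (ratio≢0 s) (prodRange≢0 (suc s) l)

  R≢0 : ∀ p → R p ≢ 0ℚ
  R≢0 = prodRange≢0 1

  K-split : ∀ {i j} → i ≤ j → K (suc j) ≡ K i ℚ.+ R i ℚ.* kij O F i j
  K-split {i} {j} i≤j = begin
    K (suc j)                                          ≡⟨ cong K (sym length) ⟩
    K (i ℕ.+ suc (j ∸ i))                              ≡⟨ KFold.fold-split 0 i (suc (j ∸ i)) ⟩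
    K i ℚ.+ sumRange weighted i (suc (j ∸ i))          ≡⟨ cong (K i ℚ.+_) rescaled ⟨
    K i ℚ.+ R i ℚ.* kij O F i j                        ∎
    where
    open ≡-Reasoning
    length : i ℕ.+ suc (j ∸ i) ≡ suc j
    length = trans (ℕP.+-suc i (j ∸ i)) (cong suc (ℕP.m+[n∸m]≡n i≤j))
    term : ∀ ν → i ≤ ν → R i ℚ.* (ι/ (k ν) ℚ.* prodRange (ratio O F) (suc i) (ν ∸ i)) ≡ weighted ν
    term ν i≤ν = begin
      R i ℚ.* (ι/ (k ν) ℚ.* prodRange (ratio O F) (suc i) (ν ∸ i))
        ≡⟨ ℚSolver.solve 3 (λ a b c → a :* (b :* c) := b :* (a :* c)) refl (R i) (ι/ (k ν)) _ ⟩
      ι/ (k ν) ℚ.* (R i ℚ.* prodRange (ratio O F) (suc i) (ν ∸ i))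
        ≡⟨ cong (ι/ (k ν) ℚ.*_) (RFold.fold-split 1 i (ν ∸ i)) ⟨
      ι/ (k ν) ℚ.* R (i ℕ.+ (ν ∸ i))
        ≡⟨ cong (λ t → ι/ (k ν) ℚ.* R t) (ℕP.m+[n∸m]≡n i≤ν) ⟩
      weighted ν ∎
      where open ℚSolver
    rescaled : R i ℚ.* kij O F i j ≡ sumRange weighted i (suc (j ∸ i))
    rescaled = trans (sumRange-scale (R i) _ i (suc (j ∸ i))) (sumRange-cong i (suc (j ∸ i)) term)

  Balanced : ℕ → ℕ → Set
  Balanced i j = ∀ d → inD d ≡ true → ρ⁺ d i ≡ ρ⁺ d (j ∸ 1)

  Congruent : ℕ → ℕ → Set
  Congruent i j = ∃ λ z → K j ≡ K i ℚ.+ scale i ℚ.* ι/ z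

  Linked : ℕ → ℕ → Set
  Linked i j = Balanced i j × Congruent i j

  cond⇒linked : ∀ {i j} → i < j → cond O F i j → Linked i j
  cond⇒linked {i} {suc b} (s≤s i≤b) (ρ≡0 , z , kij≡βz) =
    (λ d d∈D → offset-zero⇒≡ (ρ⁺-split d i≤b) (ρ≡0 d d∈D)) , z , (begin
      K (suc b)                                 ≡⟨ K-split i≤b ⟩
      K i ℚ.+ R i ℚ.* kij O F i b               ≡⟨ cong (λ t → K i ℚ.+ R i ℚ.* t) kij≡βz ⟩
      K i ℚ.+ R i ℚ.* (ι/ (β (y i)) ℚ.* ι/ z)   ≡⟨ cong (K i ℚ.+_) (rescale i z) ⟩
      K i ℚ.+ scale i ℚ.* ι/ z                  ∎)
    where
    open ≡-Reasoning
    rescale : ∀ i z → R i ℚ.* (ι/ (β (y i)) ℚ.* ι/ z) ≡ scale i ℚ.* ι/ z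
    rescale i z = ℚSolver.solve 3 (λ a b c → a :* (b :* c) := (b :* a) :* c) refl (R i) (ι/ (β (y i))) (ι/ z)
      where open ℚSolver

  linked⇒cond : ∀ {i j} → i < j → Linked i j → cond O F i j
  linked⇒cond {i} {suc b} (s≤s i≤b) (bal , z , K≡) =
    (λ d d∈D → ≡⇒offset-zero (ρ⁺-split d i≤b) (bal d d∈D)) ,
    z , *-cancelˡ-≢0 (R≢0 i) (ℚGroup.∙-cancelˡ (K i) _ _ (begin
      K i ℚ.+ R i ℚ.* kij O F i b               ≡⟨ K-split i≤b ⟨
      K (suc b)                                 ≡⟨ K≡ ⟩
      K i ℚ.+ scale i ℚ.* ι/ z                  ≡⟨ cong (K i ℚ.+_) (rescale i z) ⟩
      K i ℚ.+ R i ℚ.* (ι/ (β (y i)) ℚ.* ι/ z)   ∎))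
    where
    open ≡-Reasoning
    rescale : ∀ i z → scale i ℚ.* ι/ z ≡ R i ℚ.* (ι/ (β (y i)) ℚ.* ι/ z)
    rescale i z = ℚSolver.solve 3 (λ a b c → (b :* a) :* c := a :* (b :* c)) refl (R i) (ι/ (β (y i))) (ι/ z)
      where open ℚSolver

  bar-swap : ∀ {x z} → x ≡ bar z → z ≡ bar x
  bar-swap {x} {z} x≡z̄ = trans (sym (bar-invol z)) (cong bar (sym x≡z̄))

  -- If y_i = ȳ_j, the edge y_j undoes y_i, so Balanced is symmetric.
  balanced-sym : ∀ {i j} → 1 ≤ i → 1 ≤ j → y i ≡ bar (y j) → Balanced i j → Balanced j i
  balanced-sym {suc a} {suc b} _ _ yi≡ȳj bal d d∈D = begin
    ρ⁺ d (suc b)                                       ≡⟨ ρ⁺-snoc d b ⟩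
    ρ⁺ d b ℤ.+ ρedge O F d (y (suc b))                 ≡⟨ cong₂ ℤ._+_ (sym (bal d d∈D)) (cong (ρedge O F d) (bar-swap yi≡ȳj)) ⟩
    ρ⁺ d (suc a) ℤ.+ ρedge O F d (bar (y (suc a)))     ≡⟨ cong₂ ℤ._+_ (ρ⁺-snoc d a) (ρedge-rev d (y (suc a))) ⟩
    (ρ⁺ d a ℤ.+ e) ℤ.+ ℤ.- e                           ≡⟨ ℤSolver.solve 2 (λ p e → (p :+ e) :+ :- e := p) refl (ρ⁺ d a) e ⟩
    ρ⁺ d a                                             ∎
    where
    open ≡-Reasoning
    open ℤSolver
    e = ρedge O F d (y (suc a))

  -- Linked positions carrying mutually inverse edges have the same scale:
  -- β_j R_j = β_j R_{j−1} α_j/β_j = α_j R_i = β_i R_i.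
  balanced-scale : ∀ {i j} → 1 ≤ j → y i ≡ bar (y j) → Balanced i j → scale j ≡ scale i
  balanced-scale {i} {suc b} _ yi≡ȳj bal = begin
    ι/ βj ℚ.* R (suc b)              ≡⟨ cong (ι/ βj ℚ.*_) (R-snoc b) ⟩
    ι/ βj ℚ.* (R b ℚ.* (αj ÷ᶻ βj))   ≡⟨ ℚSolver.solve 3 (λ a b c → a :* (b :* c) := b :* (a :* c)) refl (ι/ βj) (R b) (αj ÷ᶻ βj) ⟩
    R b ℚ.* (ι/ βj ℚ.* (αj ÷ᶻ βj))   ≡⟨ cong (R b ℚ.*_) (ι/-÷ᶻ αj βj (β≢0 (y (suc b)))) ⟩
    R b ℚ.* ι/ αj                    ≡⟨ cong₂ (λ p x → p ℚ.* ι/ x) (R-cong {b} {i} (λ d d∈D → sym (bal d d∈D))) αj≡βi ⟩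
    R i ℚ.* ι/ (β (y i))             ≡⟨ ℚP.*-comm (R i) _ ⟩
    scale i                          ∎
    where
    open ≡-Reasoning
    open ℚSolver
    αj = α (y (suc b))
    βj = β (y (suc b))
    αj≡βi : αj ≡ β (y i)
    αj≡βi = trans (α-bar (y (suc b))) (cong β (sym yi≡ȳj))

  congruent-sym : ∀ {i j} → scale j ≡ scale i → Congruent i j → Congruent j i
  congruent-sym {i} {j} sj≡si (z , Kj≡) = ℤ.- z , (begin
    K i                                         ≡⟨ ℚSolver.solve 3 (λ a s z → a := (a :+ s :* z) :+ s :* (:- z)) refl (K i) (scale i) (ι/ z) ⟩
    (K i ℚ.+ scale i ℚ.* ι/ z) ℚ.+ scale i ℚ.* ℚ.- ι/ z ≡⟨ cong₂ (λ a s → a ℚ.+ s ℚ.* ℚ.- ι/ z) (sym Kj≡) (sym sj≡si) ⟩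
    K j ℚ.+ scale j ℚ.* ℚ.- ι/ z                ≡⟨ cong (λ t → K j ℚ.+ scale j ℚ.* t) (ι/-neg z) ⟨
    K j ℚ.+ scale j ℚ.* ι/ (ℤ.- z)              ∎)
    where
    open ≡-Reasoning
    open ℚSolver

  congruent-trans : ∀ {i l j} → scale l ≡ scale i → Congruent i l → Congruent l j → Congruent i j
  congruent-trans {i} {l} {j} sl≡si (z₁ , Kl≡) (z₂ , Kj≡) = z₁ ℤ.+ z₂ , (begin
    K j                                          ≡⟨ Kj≡ ⟩
    K l ℚ.+ scale l ℚ.* ι/ z₂                    ≡⟨ cong₂ (λ a s → a ℚ.+ s ℚ.* ι/ z₂) Kl≡ sl≡si ⟩
    (K i ℚ.+ scale i ℚ.* ι/ z₁) ℚ.+ scale i ℚ.* ι/ z₂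
      ≡⟨ ℚSolver.solve 4 (λ a s u v → (a :+ s :* u) :+ s :* v := a :+ s :* (u :+ v)) refl (K i) (scale i) (ι/ z₁) (ι/ z₂) ⟩
    K i ℚ.+ scale i ℚ.* (ι/ z₁ ℚ.+ ι/ z₂)        ≡⟨ cong (λ t → K i ℚ.+ scale i ℚ.* t) (ι/-+ z₁ z₂) ⟨
    K i ℚ.+ scale i ℚ.* ι/ (z₁ ℤ.+ z₂)           ∎)
    where
    open ≡-Reasoning
    open ℚSolver

  linked-sym : ∀ {i j} → 1 ≤ i → 1 ≤ j → y i ≡ bar (y j) → Linked i j → Linked j i
  linked-sym 1≤i 1≤j yi≡ȳj (bal , con) =
    balanced-sym 1≤i 1≤j yi≡ȳj bal , congruent-sym (balanced-scale 1≤j yi≡ȳj bal) con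

  ∼⇒linked : ∀ {i j} → _∼C_ O F i j → Linked i j
  ∼⇒linked {i} {j} ((1≤i , _) , (1≤j , _) , yi≡ȳj , cond-i<j , cond-j<i) with ℕP.<-cmp i j
  ... | tri< i<j _ _  = cond⇒linked i<j (cond-i<j i<j)
  ... | tri≈ _ refl _ = ⊥-elim (bar-free (y i) (sym yi≡ȳj))
  ... | tri> _ _ j<i  = linked-sym 1≤j 1≤i (bar-swap yi≡ȳj) (cond⇒linked j<i (cond-j<i j<i))

  linked⇒∼ : ∀ {i j} → 1 ≤ i × i ≤ n → 1 ≤ j × j ≤ n → y i ≡ bar (y j) → Linked i j → _∼C_ O F i j
  linked⇒∼ i-in@(1≤i , _) j-in@(1≤j , _) yi≡ȳj lnk =
    i-in , j-in , yi≡ȳj , (λ i<j → linked⇒cond i<j lnk) ,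
    (λ j<i → linked⇒cond j<i (linked-sym 1≤i 1≤j yi≡ȳj lnk))

  edge-compose : ∀ {i l m j} → _∼C_ O F i l → _∼C_ O F l m → _∼C_ O F m j → y i ≡ bar (y j)
  edge-compose (_ , _ , yi≡ȳl , _) (_ , _ , yl≡ȳm , _) (_ , _ , ym≡ȳj , _) =
    trans yi≡ȳl (trans (cong bar yl≡ȳm) (trans (bar-invol _) ym≡ȳj))

  -- Three consecutive links compose: the middle link, read backwards, connects
  -- the prefix at l−1 to the one at m, and all three links share one scale.
  linked-compose : ∀ {i l m j} → _∼C_ O F i l → _∼C_ O F l m → _∼C_ O F m j → Linked i j
  linked-compose {i} {l} {m} {j} i∼l@(_ , (1≤l , _) , yi≡ȳl , _) l∼m@(_ , (1≤m , _) , yl≡ȳm , _) m∼j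
    with ∼⇒linked i∼l | ∼⇒linked l∼m | ∼⇒linked m∼j
  ... | bal₁ , con₁ | bal₂ , con₂ | bal₃ , con₃ =
    (λ d d∈D → trans (bal₁ d d∈D) (trans (sym (balanced-sym 1≤l 1≤m yl≡ȳm bal₂ d d∈D)) (bal₃ d d∈D))) ,
    congruent-trans {i} {l} {j} (balanced-scale 1≤l yi≡ȳl bal₁) con₁
      (congruent-trans {l} {m} {j} (balanced-scale 1≤m yl≡ȳm bal₂) con₂ con₃)

mainTheorem6 : (G : GBSGraph) (O : Orientation G) (F : Factorization G) (i l m j : ℕ) →
    _∼C_ O F i l → _∼C_ O F l m → _∼C_ O F m j → _∼C_ O F i j
mainTheorem6 G O F i l m j i∼l l∼m m∼j =
  linked⇒∼ O F (proj₁ i∼l) (proj₁ (proj₂ m∼j)) (edge-compose O F i∼l l∼m m∼j)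
    (linked-compose O F i∼l l∼m m∼j)
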